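{- Let $n\ge3$ and $k\ge1$ be integers and $a,b,c\in\mathbb{Z}$, and let $\mathcal{F}(x)=(x^k+b)^n+c\sum_{i=1}^na^{i-1}(x^k+b)^{n-i}\in\mathbb{Z}[x]$ be irreducible over $\mathbb{Q}$ of degree $nk$. Suppose there is a prime $p$ with $p\mid a$ and $p\nmid c$. Then $\mathcal{F}(x)$ is not monogenic.
   Context: A monic irreducible $g\in\mathbb{Z}[x]$ is monogenic if for a root $\alpha$, $\mathbb{Z}[\alpha]$ equals the ring of integers of $\mathbb{Q}(\alpha)$. -}

module Defs where

open import Data.Nat as ℕ using (ℕ; zero; suc; _<_)
open import Data.Integer as ℤ using (ℤ)
open import Data.Rational as ℚ using (ℚ; 0ℚ; 1ℚ)
open import Data.List using (List; []; _∷_; map; foldr; upTo; _++_)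
open import Data.Product using (Σ; ∃; _×_; _,_)
open import Data.Sum using (_⊎_)
open import Relation.Binary.PropositionalEquality using (_≡_; _≢_)
open import Relation.Nullary using (¬_)

-- Polynomials over ℚ as coefficient lists, lowest degree first.
-- Two lists represent the same polynomial iff all coefficients agree
-- (trailing zeros are irrelevant).

Poly : Set
Poly = List ℚ

coeff : Poly → ℕ → ℚ
coeff []       _       = 0ℚ
coeff (a ∷ p)  zero    = a
coeff (a ∷ p)  (suc i) = coeff p i

infix 4 _≈ₚ_
_≈ₚ_ : Poly → Poly → Set
p ≈ₚ q = ∀ i → coeff p i ≡ coeff q i

ι : ℤ → ℚ
ι z = z ℚ./ 1

const : ℚ → Poly
const a = a ∷ []

X : Poly
X = 0ℚ ∷ 1ℚ ∷ []

_⊕_ : Poly → Poly → Poly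
[]      ⊕ q       = q
(a ∷ p) ⊕ []      = a ∷ p
(a ∷ p) ⊕ (b ∷ q) = (a ℚ.+ b) ∷ (p ⊕ q)

scale : ℚ → Poly → Poly
scale c = map (c ℚ.*_)

neg : Poly → Poly
neg = scale (ℚ.- 1ℚ)

_⊖_ : Poly → Poly → Poly
p ⊖ q = p ⊕ neg q

_⊗_ : Poly → Poly → Poly
[]      ⊗ q = []
(a ∷ p) ⊗ q = scale a q ⊕ (0ℚ ∷ (p ⊗ q))

_^ₚ_ : Poly → ℕ → Poly
p ^ₚ zero  = const 1ℚ
p ^ₚ suc n = p ⊗ (p ^ₚ n)

sumₚ : List Poly → Poly
sumₚ = foldr _⊕_ []

fromℤPoly : List ℤ → Poly
fromℤPoly = map ι

compose : Poly → Poly → Poly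
compose []      β = []
compose (a ∷ g) β = const a ⊕ (β ⊗ compose g β)

HasDegree : Poly → ℕ → Set
HasDegree p d = coeff p d ≢ 0ℚ × (∀ i → d < i → coeff p i ≡ 0ℚ)

IsUnit : Poly → Set
IsUnit p = Σ ℚ λ c → c ≢ 0ℚ × p ≈ₚ const c

IsZero : Poly → Set
IsZero p = p ≈ₚ []

IrreducibleOverℚ : Poly → Set
IrreducibleOverℚ f =
  ¬ IsZero f × ¬ IsUnit f ×
  (∀ g h → (g ⊗ h) ≈ₚ f → IsUnit g ⊎ IsUnit h)

-- The number field K = ℚ(α) ≅ ℚ[x]/(f) (f irreducible), α = class of x.
-- An element of K is represented by any β ∈ ℚ[x]; β represents 0 iff f ∣ β.

_∣ₚ_ : Poly → Poly → Set
f ∣ₚ r = Σ Poly λ q → (q ⊗ f) ≈ₚ r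

IsAlgebraicInteger : Poly → Poly → Set
IsAlgebraicInteger f β =
  Σ (List ℤ) λ cs → f ∣ₚ compose (fromℤPoly (cs ++ (ℤ.+ 1 ∷ []))) β

InZα : Poly → Poly → Set
InZα f β = Σ (List ℤ) λ h → f ∣ₚ (β ⊖ fromℤPoly h)

-- f is monogenic: ℤ[α] equals the ring of integers of ℚ(α).
-- (ℤ[α] ⊆ 𝒪_K always holds for monic f ∈ ℤ[x]; we state both inclusions.)
Monogenic : Poly → Set
Monogenic f =
  (∀ β → IsAlgebraicInteger f β → InZα f β) ×
  (∀ β → InZα f β → IsAlgebraicInteger f β)

𝓕 : ℕ → ℕ → ℤ → ℤ → ℤ → Poly
𝓕 n k a b c = (Y ^ₚ n) ⊕ scale (ι c) (sumₚ (map term (upTo n)))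
  where
  Y : Poly
  Y = (X ^ₚ k) ⊕ const (ι b)
  -- j = i - 1 ranges over 0 … n-1
  term : ℕ → Poly
  term j = scale (ι (a ℤ.^ j)) (Y ^ₚ (n ℕ.∸ suc j))

{-# OPTIONS --safe #-}
module Submission where

-- Write θ = xᵏ + b and Tⱼ = Σ_{i<j} aⁱ θ^(j-1-i). Then Tⱼ₊₁ = θ Tⱼ + aʲ, so
-- 𝓕 = θⁿ + c Tₙ = θ S + D with S = θⁿ⁻¹ + c Tₙ₋₁ and D = c aⁿ⁻¹.
-- Let p ∣ a, a = a′p. In ℚ(α) the element β = -S(α)/p satisfies θβ = D/p, and multiplying
-- 𝓕(α) = 0 by βⁿ shows that β is a root of yⁿ + e yⁿ⁻¹ + … + eⁿ⁻¹ y + Dⁿ⁻¹/pⁿ with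
-- e = D/(pa) = c aⁿ⁻³ a′; for n ≥ 3 these coefficients are integers, so β is integral.
-- But every element of ℤ[α] is represented by an integer polynomial of degree < nk, since
-- 𝓕 is monic, and representatives of degree < nk are unique; β is represented by -S/p,
-- of degree (n-1)k with leading coefficient -1/p ∉ ℤ. So β ∉ ℤ[α]. Here D ≠ 0: c ≠ 0 as p ∤ c, and a ≠ 0 since for a = 0
-- 𝓕 = θⁿ⁻¹ (θ + c) would be reducible.

open import Defs
open import Level using (0ℓ)
open import Function using (_∘_)
open import Data.Nat as ℕ using (ℕ; zero; suc; _≤_; z≤n; s≤s; _*_; _∸_)
import Data.Nat.Properties as ℕP
open import Data.Nat.Primality using (Prime; prime⇒nonZero; prime⇒nonTrivial)
import Data.Nat.Divisibility as ℕ∣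
open import Data.Integer as ℤ using (ℤ; +_)
import Data.Integer.Properties as ℤP
open import Data.Integer.Divisibility using (_∣_)
import Data.Integer.Divisibility.Signed as ℤ∣
open import Data.Rational as ℚ using (ℚ; 0ℚ; 1ℚ)
import Data.Rational.Properties as ℚP
import Data.Rational.Unnormalised as ℚᵘ
import Data.Rational.Unnormalised.Properties as ℚᵘP
open import Data.List using (List; []; _∷_; map; length; upTo; _++_)
open import Data.List.Properties using (map-applyUpTo; map-upTo)
open import Data.Product using (Σ; ∃; _×_; _,_; proj₁; proj₂)
open import Data.Sum using (inj₁; inj₂; [_,_]′)
open import Data.Maybe as Maybe using (Maybe; just; nothing)
open import Relation.Nullary using (¬_; Dec; yes; no)
open import Relation.Nullary.Decidable using (dec⇒maybe)
open import Relation.Binary.Bundles using (Setoid)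
open import Relation.Binary.PropositionalEquality
import Relation.Binary.Reasoning.Setoid as SetoidReasoning
open import Algebra.Bundles using (CommutativeRing)
open import Tactic.RingSolver using (solve-∀)
open import Tactic.RingSolver.Core.AlmostCommutativeRing using (AlmostCommutativeRing; fromCommutativeRing)

ℤ-ring : AlmostCommutativeRing 0ℓ 0ℓ
ℤ-ring = fromCommutativeRing ℤP.+-*-commutativeRing (λ x → Maybe.map sym (dec⇒maybe (x ℤ.≟ + 0)))

ℚ-ring : AlmostCommutativeRing 0ℓ 0ℓ
ℚ-ring = fromCommutativeRing ℚP.+-*-commutativeRing (λ x → Maybe.map sym (dec⇒maybe (x ℚ.≟ 0ℚ)))

ι-toℚᵘ : ∀ z → ℚ.toℚᵘ (ι z) ℚᵘ.≃ ℚᵘ.mkℚᵘ z 0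
ι-toℚᵘ z = ℚP.toℚᵘ-fromℚᵘ (ℚᵘ.mkℚᵘ z 0)

module _ where
  open ℚᵘP.≃-Reasoning

  ι-+ : ∀ x y → ι (x ℤ.+ y) ≡ ι x ℚ.+ ι y
  ι-+ x y = ℚP.toℚᵘ-injective (begin
    ℚ.toℚᵘ (ι (x ℤ.+ y))             ≈⟨ ι-toℚᵘ (x ℤ.+ y) ⟩
    ℚᵘ.mkℚᵘ (x ℤ.+ y) 0              ≈⟨ ℚᵘ.*≡* (identity x y) ⟩
    ℚᵘ.mkℚᵘ x 0 ℚᵘ.+ ℚᵘ.mkℚᵘ y 0     ≈⟨ ℚᵘP.+-cong (ℚᵘP.≃-sym (ι-toℚᵘ x)) (ℚᵘP.≃-sym (ι-toℚᵘ y)) ⟩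
    ℚ.toℚᵘ (ι x) ℚᵘ.+ ℚ.toℚᵘ (ι y)   ≈⟨ ℚᵘP.≃-sym (ℚP.toℚᵘ-homo-+ (ι x) (ι y)) ⟩
    ℚ.toℚᵘ (ι x ℚ.+ ι y)             ∎)
    where
    identity : ∀ x y → (x ℤ.+ y) ℤ.* (+ 1 ℤ.* + 1) ≡ (x ℤ.* + 1 ℤ.+ y ℤ.* + 1) ℤ.* + 1
    identity = solve-∀ ℤ-ring

  ι-* : ∀ x y → ι (x ℤ.* y) ≡ ι x ℚ.* ι y
  ι-* x y = ℚP.toℚᵘ-injective (begin
    ℚ.toℚᵘ (ι (x ℤ.* y))             ≈⟨ ι-toℚᵘ (x ℤ.* y) ⟩
    ℚᵘ.mkℚᵘ (x ℤ.* y) 0              ≈⟨ ℚᵘ.*≡* (identity x y) ⟩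
    ℚᵘ.mkℚᵘ x 0 ℚᵘ.* ℚᵘ.mkℚᵘ y 0     ≈⟨ ℚᵘP.*-cong (ℚᵘP.≃-sym (ι-toℚᵘ x)) (ℚᵘP.≃-sym (ι-toℚᵘ y)) ⟩
    ℚ.toℚᵘ (ι x) ℚᵘ.* ℚ.toℚᵘ (ι y)   ≈⟨ ℚᵘP.≃-sym (ℚP.toℚᵘ-homo-* (ι x) (ι y)) ⟩
    ℚ.toℚᵘ (ι x ℚ.* ι y)             ∎)
    where
    identity : ∀ x y → (x ℤ.* y) ℤ.* (+ 1 ℤ.* + 1) ≡ (x ℤ.* y) ℤ.* + 1
    identity = solve-∀ ℤ-ring

  ι-injective : ∀ {x y} → ι x ≡ ι y → x ≡ y
  ι-injective {x} {y} eq with ℚᵘP.≃-trans (ℚᵘP.≃-sym (ι-toℚᵘ x)) (ℚᵘP.≃-trans (ℚP.toℚᵘ-cong eq) (ι-toℚᵘ y))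
  ... | ℚᵘ.*≡* x*1≡y*1 = trans (sym (ℤP.*-identityʳ x)) (trans x*1≡y*1 (ℤP.*-identityʳ y))

-- Polynomial arithmetic up to coefficientwise equality

infix 4 _≋_
-- _≈ₚ_ wrapped in a record, so that both polynomials can be inferred from a proof.
record _≋_ (p q : Poly) : Set where
  constructor ⟨_⟩
  field at : p ≈ₚ q
open _≋_ public

≋-refl : ∀ {p} → p ≋ p
≋-refl = ⟨ (λ i → refl) ⟩

≋-sym : ∀ {p q} → p ≋ q → q ≋ p
≋-sym e = ⟨ (λ i → sym (at e i)) ⟩

≋-trans : ∀ {p q r} → p ≋ q → q ≋ r → p ≋ r
≋-trans e f = ⟨ (λ i → trans (at e i) (at f i)) ⟩

≋-reflexive : ∀ {p q} → p ≡ q → p ≋ q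
≋-reflexive refl = ≋-refl

≋-setoid : Setoid 0ℓ 0ℓ
≋-setoid = record
  { _≈_ = _≋_
  ; isEquivalence = record { refl = ≋-refl ; sym = ≋-sym ; trans = ≋-trans }
  }

∷-cong : ∀ {a b p q} → a ≡ b → p ≋ q → (a ∷ p) ≋ (b ∷ q)
∷-cong a≡b p≋q = ⟨ (λ { zero → a≡b ; (suc i) → at p≋q i }) ⟩

∷-injectiveʳ : ∀ {a b p q} → (a ∷ p) ≋ (b ∷ q) → p ≋ q
∷-injectiveʳ e = ⟨ (λ i → at e (suc i)) ⟩

0∷[]≋[] : (0ℚ ∷ []) ≋ []
0∷[]≋[] = ⟨ (λ { zero → refl ; (suc i) → refl }) ⟩

coeff-⊕ : ∀ p q i → coeff (p ⊕ q) i ≡ coeff p i ℚ.+ coeff q i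
coeff-⊕ []      q       i       = sym (ℚP.+-identityˡ _)
coeff-⊕ (a ∷ p) []      i       = sym (ℚP.+-identityʳ _)
coeff-⊕ (a ∷ p) (b ∷ q) zero    = refl
coeff-⊕ (a ∷ p) (b ∷ q) (suc i) = coeff-⊕ p q i

coeff-scale : ∀ c p i → coeff (scale c p) i ≡ c ℚ.* coeff p i
coeff-scale c []      i       = sym (ℚP.*-zeroʳ c)
coeff-scale c (a ∷ p) zero    = refl
coeff-scale c (a ∷ p) (suc i) = coeff-scale c p i

coeff-∷-⊗ : ∀ a p q i → coeff ((a ∷ p) ⊗ q) i ≡ a ℚ.* coeff q i ℚ.+ coeff (0ℚ ∷ (p ⊗ q)) i
coeff-∷-⊗ a p q i =
  trans (coeff-⊕ (scale a q) (0ℚ ∷ (p ⊗ q)) i) (cong (ℚ._+ coeff (0ℚ ∷ (p ⊗ q)) i) (coeff-scale a q i))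

⊕-cong : ∀ {p p′ q q′} → p ≋ p′ → q ≋ q′ → (p ⊕ q) ≋ (p′ ⊕ q′)
⊕-cong {p} {p′} {q} {q′} e f = ⟨ (λ i →
  trans (coeff-⊕ p q i) (trans (cong₂ ℚ._+_ (at e i) (at f i)) (sym (coeff-⊕ p′ q′ i)))) ⟩

⊕-congˡ : ∀ p {q q′} → q ≋ q′ → (p ⊕ q) ≋ (p ⊕ q′)
⊕-congˡ p = ⊕-cong (≋-refl {p})

⊕-congʳ : ∀ {p p′} q → p ≋ p′ → (p ⊕ q) ≋ (p′ ⊕ q)
⊕-congʳ q p≋p′ = ⊕-cong p≋p′ (≋-refl {q})

scale-cong : ∀ {c d p q} → c ≡ d → p ≋ q → scale c p ≋ scale d q
scale-cong {c} {d} {p} {q} c≡d e = ⟨ (λ i →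
  trans (coeff-scale c p i) (trans (cong₂ ℚ._*_ c≡d (at e i)) (sym (coeff-scale d q i)))) ⟩

neg-cong : ∀ {p q} → p ≋ q → neg p ≋ neg q
neg-cong = scale-cong {c = ℚ.- 1ℚ} refl

⊕-identityʳ : ∀ p → (p ⊕ []) ≋ p
⊕-identityʳ []      = ≋-refl
⊕-identityʳ (a ∷ p) = ≋-refl

⊕-comm : ∀ p q → (p ⊕ q) ≋ (q ⊕ p)
⊕-comm p q = ⟨ (λ i → begin
  coeff (p ⊕ q) i           ≡⟨ coeff-⊕ p q i ⟩
  coeff p i ℚ.+ coeff q i   ≡⟨ ℚP.+-comm (coeff p i) (coeff q i) ⟩
  coeff q i ℚ.+ coeff p i   ≡⟨ coeff-⊕ q p i ⟨
  coeff (q ⊕ p) i           ∎) ⟩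
  where open ≡-Reasoning

⊕-assoc : ∀ p q r → ((p ⊕ q) ⊕ r) ≋ (p ⊕ (q ⊕ r))
⊕-assoc p q r = ⟨ (λ i → begin
  coeff ((p ⊕ q) ⊕ r) i                       ≡⟨ coeff-⊕ (p ⊕ q) r i ⟩
  coeff (p ⊕ q) i ℚ.+ coeff r i               ≡⟨ cong (ℚ._+ coeff r i) (coeff-⊕ p q i) ⟩
  (coeff p i ℚ.+ coeff q i) ℚ.+ coeff r i     ≡⟨ ℚP.+-assoc (coeff p i) (coeff q i) (coeff r i) ⟩
  coeff p i ℚ.+ (coeff q i ℚ.+ coeff r i)     ≡⟨ cong (coeff p i ℚ.+_) (coeff-⊕ q r i) ⟨
  coeff p i ℚ.+ coeff (q ⊕ r) i               ≡⟨ coeff-⊕ p (q ⊕ r) i ⟨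
  coeff (p ⊕ (q ⊕ r)) i                       ∎) ⟩
  where open ≡-Reasoning

⊕-left-comm : ∀ p q r → (p ⊕ (q ⊕ r)) ≋ (q ⊕ (p ⊕ r))
⊕-left-comm p q r =
  ≋-trans (≋-sym (⊕-assoc p q r)) (≋-trans (⊕-cong (⊕-comm p q) ≋-refl) (⊕-assoc q p r))

⊕-interchange : ∀ p q r s → ((p ⊕ q) ⊕ (r ⊕ s)) ≋ ((p ⊕ r) ⊕ (q ⊕ s))
⊕-interchange p q r s =
  ≋-trans (⊕-assoc p q (r ⊕ s)) (≋-trans (⊕-cong (≋-refl {p}) (⊕-left-comm q r s)) (≋-sym (⊕-assoc p r (q ⊕ s))))

neg-inverseˡ : ∀ p → (neg p ⊕ p) ≋ []
neg-inverseˡ p = ⟨ (λ i → begin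
  coeff (neg p ⊕ p) i                          ≡⟨ coeff-⊕ (neg p) p i ⟩
  coeff (neg p) i ℚ.+ coeff p i                ≡⟨ cong (ℚ._+ coeff p i) (coeff-scale (ℚ.- 1ℚ) p i) ⟩
  (ℚ.- 1ℚ) ℚ.* coeff p i ℚ.+ coeff p i         ≡⟨ -1x+x≡0 (coeff p i) ⟩
  0ℚ                                           ∎) ⟩
  where
  open ≡-Reasoning
  -1x+x≡0 : ∀ x → (ℚ.- 1ℚ) ℚ.* x ℚ.+ x ≡ 0ℚ
  -1x+x≡0 = solve-∀ ℚ-ring

scale-⊕ : ∀ c p q → scale c (p ⊕ q) ≋ (scale c p ⊕ scale c q)
scale-⊕ c p q = ⟨ (λ i → begin
  coeff (scale c (p ⊕ q)) i                          ≡⟨ coeff-scale c (p ⊕ q) i ⟩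
  c ℚ.* coeff (p ⊕ q) i                              ≡⟨ cong (c ℚ.*_) (coeff-⊕ p q i) ⟩
  c ℚ.* (coeff p i ℚ.+ coeff q i)                    ≡⟨ ℚP.*-distribˡ-+ c (coeff p i) (coeff q i) ⟩
  c ℚ.* coeff p i ℚ.+ c ℚ.* coeff q i                ≡⟨ cong₂ ℚ._+_ (coeff-scale c p i) (coeff-scale c q i) ⟨
  coeff (scale c p) i ℚ.+ coeff (scale c q) i        ≡⟨ coeff-⊕ (scale c p) (scale c q) i ⟨
  coeff (scale c p ⊕ scale c q) i                    ∎) ⟩
  where open ≡-Reasoning

scale-+ : ∀ c d p → scale (c ℚ.+ d) p ≋ (scale c p ⊕ scale d p)
scale-+ c d p = ⟨ (λ i → begin
  coeff (scale (c ℚ.+ d) p) i                        ≡⟨ coeff-scale (c ℚ.+ d) p i ⟩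
  (c ℚ.+ d) ℚ.* coeff p i                            ≡⟨ ℚP.*-distribʳ-+ (coeff p i) c d ⟩
  c ℚ.* coeff p i ℚ.+ d ℚ.* coeff p i                ≡⟨ cong₂ ℚ._+_ (coeff-scale c p i) (coeff-scale d p i) ⟨
  coeff (scale c p) i ℚ.+ coeff (scale d p) i        ≡⟨ coeff-⊕ (scale c p) (scale d p) i ⟨
  coeff (scale c p ⊕ scale d p) i                    ∎) ⟩
  where open ≡-Reasoning

scale-scale : ∀ c d p → scale c (scale d p) ≋ scale (c ℚ.* d) p
scale-scale c d p = ⟨ (λ i → begin
  coeff (scale c (scale d p)) i     ≡⟨ coeff-scale c (scale d p) i ⟩
  c ℚ.* coeff (scale d p) i         ≡⟨ cong (c ℚ.*_) (coeff-scale d p i) ⟩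
  c ℚ.* (d ℚ.* coeff p i)           ≡⟨ ℚP.*-assoc c d (coeff p i) ⟨
  (c ℚ.* d) ℚ.* coeff p i           ≡⟨ coeff-scale (c ℚ.* d) p i ⟨
  coeff (scale (c ℚ.* d) p) i       ∎) ⟩
  where open ≡-Reasoning

scale-0 : ∀ p → scale 0ℚ p ≋ []
scale-0 p = ⟨ (λ i → trans (coeff-scale 0ℚ p i) (ℚP.*-zeroˡ (coeff p i))) ⟩

scale-1 : ∀ p → scale 1ℚ p ≋ p
scale-1 p = ⟨ (λ i → trans (coeff-scale 1ℚ p i) (ℚP.*-identityˡ (coeff p i))) ⟩

0∷-⊕ : ∀ p q → (0ℚ ∷ (p ⊕ q)) ≋ ((0ℚ ∷ p) ⊕ (0ℚ ∷ q))
0∷-⊕ p q = ∷-cong (sym (ℚP.+-identityˡ 0ℚ)) ≋-refl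

0∷-⊗ : ∀ p q → ((0ℚ ∷ p) ⊗ q) ≋ (0ℚ ∷ (p ⊗ q))
0∷-⊗ p q = ⊕-cong (scale-0 q) ≋-refl

⊗-zeroʳ : ∀ p → (p ⊗ []) ≋ []
⊗-zeroʳ []      = ≋-refl
⊗-zeroʳ (a ∷ p) = ≋-trans (∷-cong refl (⊗-zeroʳ p)) 0∷[]≋[]

⊗-zeroˡ : ∀ {p} q → p ≋ [] → (p ⊗ q) ≋ []
⊗-zeroˡ {[]}    q e = ≋-refl
⊗-zeroˡ {a ∷ p} q e = ≋-trans (⊕-cong (≋-trans (scale-cong (at e 0) ≋-refl) (scale-0 q))
                                       (∷-cong refl (⊗-zeroˡ {p} q ⟨ (λ i → at e (suc i)) ⟩)))
                               0∷[]≋[]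

⊗-congʳ : ∀ {p p′} q → p ≋ p′ → (p ⊗ q) ≋ (p′ ⊗ q)
⊗-congʳ {[]}    {p′}     q e = ≋-sym (⊗-zeroˡ q (≋-sym e))
⊗-congʳ {a ∷ p} {[]}     q e = ⊗-zeroˡ q e
⊗-congʳ {a ∷ p} {b ∷ p′} q e = ⊕-cong (scale-cong (at e 0) ≋-refl) (∷-cong refl (⊗-congʳ q (∷-injectiveʳ e)))

⊗-∷ʳ : ∀ p b q → (p ⊗ (b ∷ q)) ≋ (scale b p ⊕ (0ℚ ∷ (p ⊗ q)))
⊗-∷ʳ []      b q = ⟨ (λ { zero → refl ; (suc i) → refl }) ⟩
⊗-∷ʳ (a ∷ p) b q = ∷-cong (cong (ℚ._+ 0ℚ) (ℚP.*-comm a b))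
  (≋-trans (⊕-cong ≋-refl (⊗-∷ʳ p b q)) (⊕-left-comm (scale a q) (scale b p) (0ℚ ∷ (p ⊗ q))))

⊗-comm : ∀ p q → (p ⊗ q) ≋ (q ⊗ p)
⊗-comm []      q = ≋-sym (⊗-zeroʳ q)
⊗-comm (a ∷ p) q = ≋-trans (⊕-cong ≋-refl (∷-cong refl (⊗-comm p q))) (≋-sym (⊗-∷ʳ q a p))

⊗-congˡ : ∀ p {q q′} → q ≋ q′ → (p ⊗ q) ≋ (p ⊗ q′)
⊗-congˡ p {q} {q′} e = ≋-trans (⊗-comm p q) (≋-trans (⊗-congʳ p e) (⊗-comm q′ p))

⊗-cong : ∀ {p p′ q q′} → p ≋ p′ → q ≋ q′ → (p ⊗ q) ≋ (p′ ⊗ q′)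
⊗-cong {p′ = p′} {q = q} e f = ≋-trans (⊗-congʳ q e) (⊗-congˡ p′ f)

⊗-distribʳ : ∀ p q r → ((p ⊕ q) ⊗ r) ≋ ((p ⊗ r) ⊕ (q ⊗ r))
⊗-distribʳ []      q       r = ≋-refl
⊗-distribʳ (a ∷ p) []      r = ≋-sym (⊕-identityʳ _)
⊗-distribʳ (a ∷ p) (b ∷ q) r =
  ≋-trans (⊕-cong (scale-+ a b r) (≋-trans (∷-cong refl (⊗-distribʳ p q r)) (0∷-⊕ (p ⊗ r) (q ⊗ r))))
          (⊕-interchange (scale a r) (scale b r) (0ℚ ∷ (p ⊗ r)) (0ℚ ∷ (q ⊗ r)))

⊗-distribˡ : ∀ p q r → (p ⊗ (q ⊕ r)) ≋ ((p ⊗ q) ⊕ (p ⊗ r))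
⊗-distribˡ p q r =
  ≋-trans (⊗-comm p (q ⊕ r)) (≋-trans (⊗-distribʳ q r p) (⊕-cong (⊗-comm q p) (⊗-comm r p)))

scale-⊗ : ∀ c p q → (scale c p ⊗ q) ≋ scale c (p ⊗ q)
scale-⊗ c []      q = ≋-refl
scale-⊗ c (a ∷ p) q =
  ≋-trans (⊕-cong (≋-sym (scale-scale c a q)) (∷-cong (sym (ℚP.*-zeroʳ c)) (scale-⊗ c p q)))
          (≋-sym (scale-⊕ c (scale a q) (0ℚ ∷ (p ⊗ q))))

⊗-assoc : ∀ p q r → ((p ⊗ q) ⊗ r) ≋ (p ⊗ (q ⊗ r))
⊗-assoc []      q r = ≋-refl
⊗-assoc (a ∷ p) q r = ≋-trans (⊗-distribʳ (scale a q) (0ℚ ∷ (p ⊗ q)) r)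
  (⊕-cong (scale-⊗ a q r) (≋-trans (0∷-⊗ (p ⊗ q) r) (∷-cong refl (⊗-assoc p q r))))

⊗-identityˡ : ∀ p → (const 1ℚ ⊗ p) ≋ p
⊗-identityˡ p = ≋-trans (⊕-cong (scale-1 p) 0∷[]≋[]) (⊕-identityʳ p)

ℚ[x]-commutativeRing : CommutativeRing 0ℓ 0ℓ
ℚ[x]-commutativeRing = record
  { Carrier = Poly ; _≈_ = _≋_ ; _+_ = _⊕_ ; _*_ = _⊗_ ; -_ = neg ; 0# = [] ; 1# = const 1ℚ
  ; isCommutativeRing = record
    { isRing = record
      { +-isAbelianGroup = record
        { isGroup = record
          { isMonoid = record
            { isSemigroup = record
              { isMagma = record { isEquivalence = Setoid.isEquivalence ≋-setoid ; ∙-cong = ⊕-cong }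
              ; assoc = ⊕-assoc }
            ; identity = (λ p → ≋-refl) , ⊕-identityʳ }
          ; inverse = neg-inverseˡ , (λ p → ≋-trans (⊕-comm p (neg p)) (neg-inverseˡ p))
          ; ⁻¹-cong = neg-cong }
        ; comm = ⊕-comm }
      ; *-cong = ⊗-cong
      ; *-assoc = ⊗-assoc
      ; *-identity = ⊗-identityˡ , (λ p → ≋-trans (⊗-comm p (const 1ℚ)) (⊗-identityˡ p))
      ; distrib = ⊗-distribˡ , (λ p q r → ⊗-distribʳ q r p) }
    ; *-comm = ⊗-comm }
  }

[]≋? : ∀ p → Maybe ([] ≋ p)
[]≋? []      = just ≋-refl
[]≋? (a ∷ p) with a ℚ.≟ 0ℚ | []≋? p
... | yes a≡0 | just []≋p = just ⟨ (λ { zero → sym a≡0 ; (suc i) → at []≋p i }) ⟩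
... | _       | _         = nothing

ℚ[x] : AlmostCommutativeRing 0ℓ 0ℓ
ℚ[x] = fromCommutativeRing ℚ[x]-commutativeRing []≋?

constℤ : ℤ → Poly
constℤ z = const (ι z)

const-⊗ : ∀ c p → (const c ⊗ p) ≋ scale c p
const-⊗ c p = ≋-trans (⊕-cong (≋-refl {scale c p}) 0∷[]≋[]) (⊕-identityʳ (scale c p))

coeff-const-⊗ : ∀ c p i → coeff (const c ⊗ p) i ≡ c ℚ.* coeff p i
coeff-const-⊗ c p i = trans (at (const-⊗ c p) i) (coeff-scale c p i)

const-* : ∀ x y → const (x ℚ.* y) ≋ (const x ⊗ const y)
const-* x y = ∷-cong (sym (ℚP.+-identityʳ (x ℚ.* y))) ≋-refl

constℤ-* : ∀ x y → constℤ (x ℤ.* y) ≋ (constℤ x ⊗ constℤ y)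
constℤ-* x y = ≋-trans (∷-cong (ι-* x y) ≋-refl) (const-* (ι x) (ι y))

constℤ-^ : ∀ z j → constℤ (z ℤ.^ j) ≋ (constℤ z ^ₚ j)
constℤ-^ z zero    = ≋-refl
constℤ-^ z (suc j) = ≋-trans (constℤ-* z (z ℤ.^ j)) (⊗-congˡ (constℤ z) (constℤ-^ z j))

^ₚ-distrib-⊗ : ∀ p q j → ((p ⊗ q) ^ₚ j) ≋ ((p ^ₚ j) ⊗ (q ^ₚ j))
^ₚ-distrib-⊗ p q zero    = ≋-sym (⊗-identityˡ (const 1ℚ))
^ₚ-distrib-⊗ p q (suc j) =
  ≋-trans (⊗-congˡ (p ⊗ q) (^ₚ-distrib-⊗ p q j)) (interchange p q (p ^ₚ j) (q ^ₚ j))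
  where
  interchange : ∀ p q r s → ((p ⊗ q) ⊗ (r ⊗ s)) ≋ ((p ⊗ r) ⊗ (q ⊗ s))
  interchange = solve-∀ ℚ[x]

-- Congruence modulo a polynomial

infix 4 _≡_mod_
record _≡_mod_ (x y M : Poly) : Set where
  constructor divides
  field
    quotient : Poly
    equality : (quotient ⊗ M) ≋ (x ⊖ y)

module _ {M : Poly} where

  ≋⇒≡mod : ∀ {x y} → x ≋ y → x ≡ y mod M
  ≋⇒≡mod {x} {y} x≋y = divides [] (≋-sym (≋-trans (⊕-cong x≋y ≋-refl) (x-x≋0 y)))
    where
    x-x≋0 : ∀ x → (x ⊕ neg x) ≋ []
    x-x≋0 = solve-∀ ℚ[x]

  ≡mod-refl : ∀ {x} → x ≡ x mod M
  ≡mod-refl = ≋⇒≡mod ≋-refl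

  ≡mod-sym : ∀ {x y} → x ≡ y mod M → y ≡ x mod M
  ≡mod-sym {x} {y} (divides q e) =
    divides (neg q) (≋-trans (neg-⊗ q M) (≋-trans (neg-cong e) (neg-[x-y] x y)))
    where
    neg-⊗ : ∀ q M → (neg q ⊗ M) ≋ neg (q ⊗ M)
    neg-⊗ = solve-∀ ℚ[x]
    neg-[x-y] : ∀ x y → neg (x ⊕ neg y) ≋ (y ⊕ neg x)
    neg-[x-y] = solve-∀ ℚ[x]

  ≡mod-trans : ∀ {x y z} → x ≡ y mod M → y ≡ z mod M → x ≡ z mod M
  ≡mod-trans {x} {y} {z} (divides q e) (divides r f) =
    divides (q ⊕ r) (≋-trans (⊗-distribʳ q r M) (≋-trans (⊕-cong e f) (telescope x y z)))
    where
    telescope : ∀ x y z → ((x ⊕ neg y) ⊕ (y ⊕ neg z)) ≋ (x ⊕ neg z)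
    telescope = solve-∀ ℚ[x]

  ⊕-cong-mod : ∀ {x x′ y y′} → x ≡ x′ mod M → y ≡ y′ mod M → (x ⊕ y) ≡ (x′ ⊕ y′) mod M
  ⊕-cong-mod {x} {x′} {y} {y′} (divides q e) (divides r f) =
    divides (q ⊕ r) (≋-trans (⊗-distribʳ q r M) (≋-trans (⊕-cong e f) (regroup x x′ y y′)))
    where
    regroup : ∀ x x′ y y′ → ((x ⊕ neg x′) ⊕ (y ⊕ neg y′)) ≋ ((x ⊕ y) ⊕ neg (x′ ⊕ y′))
    regroup = solve-∀ ℚ[x]

  ⊗-cong-mod : ∀ {x x′ y y′} → x ≡ x′ mod M → y ≡ y′ mod M → (x ⊗ y) ≡ (x′ ⊗ y′) mod M
  ⊗-cong-mod {x} {x′} {y} {y′} (divides q e) (divides r f) =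
    divides ((x ⊗ r) ⊕ (q ⊗ y′))
      (≋-trans (expand x r q y′ M) (≋-trans (⊕-cong (⊗-congˡ x f) (⊗-congʳ y′ e)) (regroup x x′ y y′)))
    where
    expand : ∀ x r q y′ M → (((x ⊗ r) ⊕ (q ⊗ y′)) ⊗ M) ≋ ((x ⊗ (r ⊗ M)) ⊕ ((q ⊗ M) ⊗ y′))
    expand = solve-∀ ℚ[x]
    regroup : ∀ x x′ y y′ → ((x ⊗ (y ⊕ neg y′)) ⊕ ((x ⊕ neg x′) ⊗ y′)) ≋ ((x ⊗ y) ⊕ neg (x′ ⊗ y′))
    regroup = solve-∀ ℚ[x]

  ⊗-congˡ-mod : ∀ x {y y′} → y ≡ y′ mod M → (x ⊗ y) ≡ (x ⊗ y′) mod M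
  ⊗-congˡ-mod x = ⊗-cong-mod (≡mod-refl {x})

  ^ₚ-cong-mod : ∀ {x y} j → x ≡ y mod M → (x ^ₚ j) ≡ (y ^ₚ j) mod M
  ^ₚ-cong-mod zero    x≡y = ≡mod-refl
  ^ₚ-cong-mod (suc j) x≡y = ⊗-cong-mod x≡y (^ₚ-cong-mod j x≡y)

  modulus≡0 : M ≡ [] mod M
  modulus≡0 = divides (const 1ℚ) (≋-trans (⊗-identityˡ M) (≋-sym (⊕-identityʳ M)))

  ∣ₚ⇒≡mod : ∀ {x y} → M ∣ₚ (x ⊖ y) → x ≡ y mod M
  ∣ₚ⇒≡mod (q , q⊗M≈x-y) = divides q ⟨ q⊗M≈x-y ⟩

  ≡mod[]⇒∣ₚ : ∀ {x} → x ≡ [] mod M → M ∣ₚ x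
  ≡mod[]⇒∣ₚ {x} (divides q q⊗M≋x-0) = q , at (≋-trans q⊗M≋x-0 (⊕-identityʳ x))

  ≡mod-setoid : Setoid 0ℓ 0ℓ
  ≡mod-setoid = record
    { _≈_ = λ x y → x ≡ y mod M
    ; isEquivalence = record { refl = ≡mod-refl ; sym = ≡mod-sym ; trans = ≡mod-trans }
    }

const-⊗-cancel-mod : ∀ {M x} c .{{_ : ℚ.NonZero c}} → (const c ⊗ x) ≡ [] mod M → x ≡ [] mod M
const-⊗-cancel-mod {M} {x} c c⊗x≡0 = begin
  x                                   ≈⟨ ≋⇒≡mod (≋-sym c⁻¹⊗c⊗x≋x) ⟩
  const (ℚ.1/ c) ⊗ (const c ⊗ x)      ≈⟨ ⊗-congˡ-mod (const (ℚ.1/ c)) c⊗x≡0 ⟩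
  const (ℚ.1/ c) ⊗ []                 ≈⟨ ≋⇒≡mod (⊗-zeroʳ (const (ℚ.1/ c))) ⟩
  []                                  ∎
  where
  open SetoidReasoning (≡mod-setoid {M})
  c⁻¹⊗c⊗x≋x : (const (ℚ.1/ c) ⊗ (const c ⊗ x)) ≋ x
  c⁻¹⊗c⊗x≋x = ≋-trans (≋-sym (⊗-assoc (const (ℚ.1/ c)) (const c) x))
    (≋-trans (⊗-congʳ x (≋-trans (≋-sym (const-* (ℚ.1/ c) c)) (∷-cong (ℚP.*-inverseˡ c) (≋-refl {[]})))) (⊗-identityˡ x))

-- Degrees and monic polynomials

DegreeBelow : Poly → ℕ → Set
DegreeBelow p n = ∀ i → n ≤ i → coeff p i ≡ 0ℚ

MonicOfDegree : Poly → ℕ → Set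
MonicOfDegree p d = DegreeBelow p (suc d) × coeff p d ≡ 1ℚ

DegreeBelow-0⇒≋[] : ∀ p → DegreeBelow p 0 → p ≋ []
DegreeBelow-0⇒≋[] p p<0 = ⟨ (λ i → p<0 i z≤n) ⟩

DegreeBelow-≋ : ∀ {p q n} → p ≋ q → DegreeBelow p n → DegreeBelow q n
DegreeBelow-≋ p≋q p<n i n≤i = trans (sym (at p≋q i)) (p<n i n≤i)

DegreeBelow-mono : ∀ p {m n} → m ≤ n → DegreeBelow p m → DegreeBelow p n
DegreeBelow-mono p m≤n p<m i n≤i = p<m i (ℕP.≤-trans m≤n n≤i)

DegreeBelow-length : ∀ p → DegreeBelow p (length p)
DegreeBelow-length []      i       _         = refl
DegreeBelow-length (a ∷ p) (suc i) (s≤s n≤i) = DegreeBelow-length p i n≤i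

DegreeBelow-const : ∀ c → DegreeBelow (const c) 1
DegreeBelow-const c (suc i) _ = refl

DegreeBelow-⊕ : ∀ p q {n} → DegreeBelow p n → DegreeBelow q n → DegreeBelow (p ⊕ q) n
DegreeBelow-⊕ p q p<n q<n i n≤i =
  trans (coeff-⊕ p q i) (trans (cong₂ ℚ._+_ (p<n i n≤i) (q<n i n≤i)) (ℚP.+-identityˡ 0ℚ))

DegreeBelow-scale : ∀ c p {n} → DegreeBelow p n → DegreeBelow (scale c p) n
DegreeBelow-scale c p p<n i n≤i = trans (coeff-scale c p i) (trans (cong (c ℚ.*_) (p<n i n≤i)) (ℚP.*-zeroʳ c))

DegreeBelow-const-⊗ : ∀ c p {n} → DegreeBelow p n → DegreeBelow (const c ⊗ p) n
DegreeBelow-const-⊗ c p p<n = DegreeBelow-≋ (≋-sym (const-⊗ c p)) (DegreeBelow-scale c p p<n)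

DegreeBelow-⊗ : ∀ p q {m e} → DegreeBelow p m → DegreeBelow q (suc e) → DegreeBelow (p ⊗ q) (m ℕ.+ e)
DegreeBelow-⊗ p       q {zero}  p<0 _   i _ = at (⊗-zeroˡ q (DegreeBelow-0⇒≋[] p p<0)) i
DegreeBelow-⊗ []      q {suc m} _   _   i _ = refl
DegreeBelow-⊗ (a ∷ p) q {suc m} p<m q<e (suc i) (s≤s m+e≤i) = begin
  coeff ((a ∷ p) ⊗ q) (suc i)                ≡⟨ coeff-∷-⊗ a p q (suc i) ⟩
  a ℚ.* coeff q (suc i) ℚ.+ coeff (p ⊗ q) i  ≡⟨ cong₂ (λ x y → a ℚ.* x ℚ.+ y) q-vanishes p⊗q-vanishes ⟩
  a ℚ.* 0ℚ ℚ.+ 0ℚ                            ≡⟨ cong (ℚ._+ 0ℚ) (ℚP.*-zeroʳ a) ⟩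
  0ℚ                                         ∎
  where
  open ≡-Reasoning
  q-vanishes : coeff q (suc i) ≡ 0ℚ
  q-vanishes = q<e (suc i) (s≤s (ℕP.≤-trans (ℕP.m≤n+m _ m) m+e≤i))
  p⊗q-vanishes : coeff (p ⊗ q) i ≡ 0ℚ
  p⊗q-vanishes = DegreeBelow-⊗ p q (λ j m≤j → p<m (suc j) (s≤s m≤j)) q<e i m+e≤i

coeff-⊗-top : ∀ p q {d e} → DegreeBelow p (suc d) → DegreeBelow q (suc e) →
              coeff (p ⊗ q) (d ℕ.+ e) ≡ coeff p d ℚ.* coeff q e
coeff-⊗-top []      q {e = e} _   _   = sym (ℚP.*-zeroˡ (coeff q e))
coeff-⊗-top (a ∷ p) q {zero} {e} p<1 q<e =
  trans (coeff-∷-⊗ a p q e) (trans (cong (a ℚ.* coeff q e ℚ.+_) p⊗q-vanishes) (ℚP.+-identityʳ _))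
  where
  p⊗q-vanishes : coeff (0ℚ ∷ (p ⊗ q)) e ≡ 0ℚ
  p⊗q-vanishes = at (≋-trans (∷-cong refl (⊗-zeroˡ q (DegreeBelow-0⇒≋[] p (λ j _ → p<1 (suc j) (s≤s z≤n))))) 0∷[]≋[]) e
coeff-⊗-top (a ∷ p) q {suc d} {e} p<d q<e = begin
  coeff ((a ∷ p) ⊗ q) (suc (d ℕ.+ e))                  ≡⟨ coeff-∷-⊗ a p q (suc (d ℕ.+ e)) ⟩
  a ℚ.* coeff q (suc (d ℕ.+ e)) ℚ.+ coeff (p ⊗ q) (d ℕ.+ e)
    ≡⟨ cong₂ (λ x y → a ℚ.* x ℚ.+ y) (q<e _ (s≤s (ℕP.m≤n+m e d))) (coeff-⊗-top p q (λ j d<j → p<d (suc j) (s≤s d<j)) q<e) ⟩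
  a ℚ.* 0ℚ ℚ.+ coeff p d ℚ.* coeff q e                ≡⟨ cong (ℚ._+ coeff p d ℚ.* coeff q e) (ℚP.*-zeroʳ a) ⟩
  0ℚ ℚ.+ coeff p d ℚ.* coeff q e                       ≡⟨ ℚP.+-identityˡ _ ⟩
  coeff p d ℚ.* coeff q e                              ∎
  where open ≡-Reasoning

MonicOfDegree-⊗ : ∀ p q {d e} → MonicOfDegree p d → MonicOfDegree q e → MonicOfDegree (p ⊗ q) (d ℕ.+ e)
MonicOfDegree-⊗ p q (p<d , p-top) (q<e , q-top) =
  DegreeBelow-⊗ p q p<d q<e ,
  trans (coeff-⊗-top p q p<d q<e) (trans (cong₂ ℚ._*_ p-top q-top) (ℚP.*-identityˡ 1ℚ))

MonicOfDegree-^ : ∀ p {d} → MonicOfDegree p d → ∀ j → MonicOfDegree (p ^ₚ j) (j * d)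
MonicOfDegree-^ p p-monic zero    = DegreeBelow-const 1ℚ , refl
MonicOfDegree-^ p p-monic (suc j) = MonicOfDegree-⊗ p (p ^ₚ j) p-monic (MonicOfDegree-^ p p-monic j)

MonicOfDegree-⊕ : ∀ p q {d} → MonicOfDegree p d → DegreeBelow q d → MonicOfDegree (p ⊕ q) d
MonicOfDegree-⊕ p q {d} (p<d , p-top) q<d =
  DegreeBelow-⊕ p q p<d (DegreeBelow-mono q (ℕP.n≤1+n d) q<d) ,
  trans (coeff-⊕ p q d) (trans (cong₂ ℚ._+_ p-top (q<d d ℕP.≤-refl)) (ℚP.+-identityʳ 1ℚ))

X^-monic : ∀ k → MonicOfDegree (X ^ₚ k) k
X^-monic k = subst (MonicOfDegree (X ^ₚ k)) (ℕP.*-identityʳ k) (MonicOfDegree-^ X X-monic k)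
  where
  X-monic : MonicOfDegree X 1
  X-monic = (λ { (suc zero) (s≤s ()) ; (suc (suc i)) _ → refl }) , refl

monic⇒¬IsUnit : ∀ p {d} .{{_ : ℕ.NonZero d}} → MonicOfDegree p d → ¬ IsUnit p
monic⇒¬IsUnit p {suc d} (_ , p-top) (c , _ , p≈c) = ℚP.1≢0 (trans (sym p-top) (p≈c (suc d)))

-- Downward induction on a degree bound e of Q: the coefficient of Q in degree e - 1
-- reappears as the coefficient of Q ⊗ M in degree e - 1 + d.
monic-⊗-cancel : ∀ {M d} → MonicOfDegree M d → ∀ Q → DegreeBelow (Q ⊗ M) d → Q ≋ []
monic-⊗-cancel {M} {d} (M<d , M-top) Q Q⊗M<d = go (length Q) (DegreeBelow-length Q)
  where
  go : ∀ e → DegreeBelow Q e → Q ≋ []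
  go zero    Q<0 = DegreeBelow-0⇒≋[] Q Q<0
  go (suc e) Q<e = go e Q<e′
    where
    top-vanishes : coeff Q e ≡ 0ℚ
    top-vanishes = begin
      coeff Q e                ≡⟨ ℚP.*-identityʳ (coeff Q e) ⟨
      coeff Q e ℚ.* 1ℚ         ≡⟨ cong (coeff Q e ℚ.*_) M-top ⟨
      coeff Q e ℚ.* coeff M d  ≡⟨ coeff-⊗-top Q M Q<e M<d ⟨
      coeff (Q ⊗ M) (e ℕ.+ d)  ≡⟨ Q⊗M<d (e ℕ.+ d) (ℕP.m≤n+m d e) ⟩
      0ℚ                       ∎
      where open ≡-Reasoning
    Q<e′ : DegreeBelow Q e
    Q<e′ i e≤i with ℕP.m≤n⇒m<n∨m≡n e≤i
    ... | inj₁ e<i    = Q<e i e<i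
    ... | inj₂ refl   = top-vanishes

≡mod-reduced⇒≋ : ∀ {M d x y} → MonicOfDegree M d → DegreeBelow x d → DegreeBelow y d → x ≡ y mod M → x ≋ y
≡mod-reduced⇒≋ {M} {d} {x} {y} M-monic x<d y<d (divides q q⊗M≋x-y) =
  ≋-trans (split x y) (⊕-cong x-y≋0 (≋-refl {y}))
  where
  split : ∀ x y → x ≋ ((x ⊕ neg y) ⊕ y)
  split = solve-∀ ℚ[x]
  q⊗M<d : DegreeBelow (q ⊗ M) d
  q⊗M<d = DegreeBelow-≋ (≋-sym q⊗M≋x-y) (DegreeBelow-⊕ x (neg y) x<d (DegreeBelow-scale (ℚ.- 1ℚ) y y<d))
  x-y≋0 : (x ⊕ neg y) ≋ []
  x-y≋0 = ≋-trans (≋-sym q⊗M≋x-y) (⊗-zeroˡ M (monic-⊗-cancel M-monic q q⊗M<d))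

-- Integer coefficients and reduction modulo a monic polynomial

Isℤ : ℚ → Set
Isℤ c = ∃ λ z → c ≡ ι z

Isℤ-+ : ∀ {x y} → Isℤ x → Isℤ y → Isℤ (x ℚ.+ y)
Isℤ-+ (z , refl) (w , refl) = z ℤ.+ w , sym (ι-+ z w)

Isℤ-* : ∀ {x y} → Isℤ x → Isℤ y → Isℤ (x ℚ.* y)
Isℤ-* (z , refl) (w , refl) = z ℤ.* w , sym (ι-* z w)

ι-nonZero : ∀ p .{{_ : ℕ.NonZero p}} → ℚ.NonZero (ι (+ p))
ι-nonZero p = ℚ.≢-nonZero (λ ιp≡0 → ℕ.≢-nonZero⁻¹ p (ℤP.+-injective (ι-injective ιp≡0)))

p*x≡-1⇒¬Isℤ[x] : ∀ p {x} → p ≢ 1 → ι (+ p) ℚ.* x ≡ ℚ.- 1ℚ → ¬ Isℤ x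
p*x≡-1⇒¬Isℤ[x] p p≢1 px≡-1 (z , refl) =
  p≢1 (ℕP.m*n≡1⇒m≡1 p ℤ.∣ z ∣ (trans (sym (ℤP.abs-* (+ p) z)) (cong ℤ.∣_∣ pz≡-1)))
  where
  pz≡-1 : + p ℤ.* z ≡ ℤ.- + 1
  pz≡-1 = ι-injective (trans (ι-* (+ p) z) px≡-1)

record HasℤCoeffs (p : Poly) : Set where
  constructor ℤ-coeffs
  field isℤ : ∀ i → Isℤ (coeff p i)
open HasℤCoeffs public

HasℤCoeffs-[] : HasℤCoeffs []
HasℤCoeffs-[] = ℤ-coeffs (λ i → + 0 , refl)

HasℤCoeffs-∷ : ∀ {a p} → Isℤ a → HasℤCoeffs p → HasℤCoeffs (a ∷ p)
HasℤCoeffs-∷ a-ℤ p-ℤ = ℤ-coeffs (λ { zero → a-ℤ ; (suc i) → isℤ p-ℤ i })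

HasℤCoeffs-constℤ : ∀ z → HasℤCoeffs (constℤ z)
HasℤCoeffs-constℤ z = HasℤCoeffs-∷ (z , refl) HasℤCoeffs-[]

HasℤCoeffs-X : HasℤCoeffs X
HasℤCoeffs-X = HasℤCoeffs-∷ (+ 0 , refl) (HasℤCoeffs-constℤ (+ 1))

HasℤCoeffs-⊕ : ∀ p q → HasℤCoeffs p → HasℤCoeffs q → HasℤCoeffs (p ⊕ q)
HasℤCoeffs-⊕ p q p-ℤ q-ℤ = ℤ-coeffs (λ i →
  subst Isℤ (sym (coeff-⊕ p q i)) (Isℤ-+ (isℤ p-ℤ i) (isℤ q-ℤ i)))

HasℤCoeffs-scale : ∀ {c} p → Isℤ c → HasℤCoeffs p → HasℤCoeffs (scale c p)
HasℤCoeffs-scale {c} p c-ℤ p-ℤ = ℤ-coeffs (λ i →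
  subst Isℤ (sym (coeff-scale c p i)) (Isℤ-* c-ℤ (isℤ p-ℤ i)))

HasℤCoeffs-⊗ : ∀ p q → HasℤCoeffs p → HasℤCoeffs q → HasℤCoeffs (p ⊗ q)
HasℤCoeffs-⊗ []      q _   _   = HasℤCoeffs-[]
HasℤCoeffs-⊗ (a ∷ p) q p-ℤ q-ℤ = HasℤCoeffs-⊕ (scale a q) (0ℚ ∷ (p ⊗ q))
  (HasℤCoeffs-scale q (isℤ p-ℤ 0) q-ℤ)
  (HasℤCoeffs-∷ (+ 0 , refl) (HasℤCoeffs-⊗ p q (ℤ-coeffs (isℤ p-ℤ ∘ suc)) q-ℤ))

HasℤCoeffs-^ : ∀ p → HasℤCoeffs p → ∀ j → HasℤCoeffs (p ^ₚ j)
HasℤCoeffs-^ p p-ℤ zero    = HasℤCoeffs-constℤ (+ 1)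
HasℤCoeffs-^ p p-ℤ (suc j) = HasℤCoeffs-⊗ p (p ^ₚ j) p-ℤ (HasℤCoeffs-^ p p-ℤ j)

HasℤCoeffs-sumₚ : ∀ (f : ℕ → Poly) xs → (∀ x → HasℤCoeffs (f x)) → HasℤCoeffs (sumₚ (map f xs))
HasℤCoeffs-sumₚ f []       f-ℤ = HasℤCoeffs-[]
HasℤCoeffs-sumₚ f (x ∷ xs) f-ℤ = HasℤCoeffs-⊕ (f x) (sumₚ (map f xs)) (f-ℤ x) (HasℤCoeffs-sumₚ f xs f-ℤ)

∷-cong-mod : ∀ {M x y} a → x ≡ y mod M → (a ∷ x) ≡ (a ∷ y) mod M
∷-cong-mod {M} a (divides q q⊗M≋x-y) =
  divides (0ℚ ∷ q) (≋-trans (0∷-⊗ q M) (∷-cong (sym (a-a≡0 a)) q⊗M≋x-y))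
  where
  a-a≡0 : ∀ a → a ℚ.+ (ℚ.- 1ℚ) ℚ.* a ≡ 0ℚ
  a-a≡0 = solve-∀ ℚ-ring

module _ {M d} (M-monic : MonicOfDegree M d) (M-ℤ : HasℤCoeffs M) where

  lower-degree-mod : ∀ r → HasℤCoeffs r → DegreeBelow r (suc d) →
               ∃ λ r′ → HasℤCoeffs r′ × DegreeBelow r′ d × r ≡ r′ mod M
  lower-degree-mod r r-ℤ r<d+1 = r′ , r′-ℤ , r′<d , divides (constℤ z) (cancel r (constℤ z ⊗ M))
    where
    z : ℤ
    z = proj₁ (isℤ r-ℤ d)
    r′ : Poly
    r′ = r ⊕ neg (constℤ z ⊗ M)
    cancel : ∀ r s → s ≋ (r ⊕ neg (r ⊕ neg s))
    cancel = solve-∀ ℚ[x]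
    r′-ℤ : HasℤCoeffs r′
    r′-ℤ = HasℤCoeffs-⊕ r _ r-ℤ (HasℤCoeffs-scale _ (ℤ.- + 1 , refl)
             (HasℤCoeffs-⊗ (constℤ z) M (HasℤCoeffs-constℤ z) M-ℤ))
    coeff-r′ : ∀ i → coeff r′ i ≡ coeff r i ℚ.+ (ℚ.- 1ℚ) ℚ.* (ι z ℚ.* coeff M i)
    coeff-r′ i = trans (coeff-⊕ r (neg (constℤ z ⊗ M)) i) (cong (coeff r i ℚ.+_)
                   (trans (coeff-scale (ℚ.- 1ℚ) (constℤ z ⊗ M) i) (cong ((ℚ.- 1ℚ) ℚ.*_) (coeff-const-⊗ (ι z) M i))))
    0-x0≡0 : ∀ x → 0ℚ ℚ.+ (ℚ.- 1ℚ) ℚ.* (x ℚ.* 0ℚ) ≡ 0ℚ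
    0-x0≡0 = solve-∀ ℚ-ring
    x-x1≡0 : ∀ x → x ℚ.+ (ℚ.- 1ℚ) ℚ.* (x ℚ.* 1ℚ) ≡ 0ℚ
    x-x1≡0 = solve-∀ ℚ-ring
    r′<d : DegreeBelow r′ d
    r′<d i d≤i with ℕP.m≤n⇒m<n∨m≡n d≤i
    ... | inj₁ d<i  = trans (coeff-r′ i)
                        (trans (cong₂ (λ x y → x ℚ.+ (ℚ.- 1ℚ) ℚ.* (ι z ℚ.* y)) (r<d+1 i d<i) (proj₁ M-monic i d<i))
                               (0-x0≡0 (ι z)))
    ... | inj₂ refl = trans (coeff-r′ d)
                        (trans (cong₂ (λ x y → x ℚ.+ (ℚ.- 1ℚ) ℚ.* (ι z ℚ.* y)) (proj₂ (isℤ r-ℤ d)) (proj₂ M-monic))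
                               (x-x1≡0 (ι z)))

  reduce-mod-monic : ∀ h → ∃ λ r → HasℤCoeffs r × DegreeBelow r d × fromℤPoly h ≡ r mod M
  reduce-mod-monic []      = [] , HasℤCoeffs-[] , (λ _ _ → refl) , ≡mod-refl
  reduce-mod-monic (z ∷ h) =
    let r , r-ℤ , r<d , h≡r = reduce-mod-monic h
        r′ , r′-ℤ , r′<d , r≡r′ = lower-degree-mod (ι z ∷ r) (HasℤCoeffs-∷ (z , refl) r-ℤ) (λ { (suc i) (s≤s d≤i) → r<d i d≤i })
    in r′ , r′-ℤ , r′<d , ≡mod-trans (∷-cong-mod (ι z) h≡r) r≡r′

sumₚ-map-cong : ∀ {f g : ℕ → Poly} xs → (∀ x → f x ≋ g x) → sumₚ (map f xs) ≋ sumₚ (map g xs)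
sumₚ-map-cong []       f≋g = ≋-refl
sumₚ-map-cong (x ∷ xs) f≋g = ⊕-cong (f≋g x) (sumₚ-map-cong xs f≋g)

sumₚ-map-const-⊗ : ∀ c (f : ℕ → Poly) xs → sumₚ (map (λ x → const c ⊗ f x) xs) ≋ (const c ⊗ sumₚ (map f xs))
sumₚ-map-const-⊗ c f []       = ≋-sym (⊗-zeroʳ (const c))
sumₚ-map-const-⊗ c f (x ∷ xs) =
  ≋-trans (⊕-congˡ (const c ⊗ f x) (sumₚ-map-const-⊗ c f xs)) (≋-sym (⊗-distribˡ (const c) (f x) _))

sumₚ-upTo-suc : ∀ (f : ℕ → Poly) n → sumₚ (map f (upTo (suc n))) ≡ f 0 ⊕ sumₚ (map (f ∘ suc) (upTo n))
sumₚ-upTo-suc f n = cong (λ xs → f 0 ⊕ sumₚ xs) (trans (map-applyUpTo suc f n) (sym (map-upTo (f ∘ suc) n)))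

descendingPowers : ℤ → ℕ → List ℤ
descendingPowers e zero    = []
descendingPowers e (suc j) = e ℤ.^ suc j ∷ descendingPowers e j

-- βʲ + e βʲ⁻¹ + … + eʲ, written as a Horner evaluation so that it is visibly a monic
-- integer polynomial in β.
geomSumAt : ℤ → Poly → ℕ → Poly
geomSumAt e β j = compose (fromℤPoly (descendingPowers e j ++ (+ 1 ∷ []))) β

geomSumAt-0 : ∀ e β → geomSumAt e β 0 ≋ const 1ℚ
geomSumAt-0 e β = ⊕-congˡ (const 1ℚ) (⊗-zeroʳ β)

geomSumAt-suc : ∀ e β j → geomSumAt e β (suc j) ≋ ((β ^ₚ suc j) ⊕ (constℤ e ⊗ geomSumAt e β j))
geomSumAt-suc e β zero = begin
  constℤ (e ℤ.^ 1) ⊕ (β ⊗ geomSumAt e β 0)           ≈⟨ ⊕-cong (constℤ-^ e 1) (⊗-congˡ β P₀≋1) ⟩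
  (constℤ e ⊗ const 1ℚ) ⊕ (β ⊗ const 1ℚ)             ≈⟨ ⊕-comm (constℤ e ⊗ const 1ℚ) (β ⊗ const 1ℚ) ⟩
  (β ⊗ const 1ℚ) ⊕ (constℤ e ⊗ const 1ℚ)             ≈⟨ ⊕-congˡ (β ⊗ const 1ℚ) (⊗-congˡ (constℤ e) (≋-sym P₀≋1)) ⟩
  (β ⊗ const 1ℚ) ⊕ (constℤ e ⊗ geomSumAt e β 0)     ∎
  where
  open SetoidReasoning ≋-setoid
  P₀≋1 : geomSumAt e β 0 ≋ const 1ℚ
  P₀≋1 = geomSumAt-0 e β
geomSumAt-suc e β (suc j) = begin
  constℤ (e ℤ.* e ℤ.^ suc j) ⊕ (β ⊗ geomSumAt e β (suc j))
    ≈⟨ ⊕-cong (constℤ-* e (e ℤ.^ suc j)) (⊗-congˡ β (geomSumAt-suc e β j)) ⟩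
  (constℤ e ⊗ constℤ (e ℤ.^ suc j)) ⊕ (β ⊗ ((β ^ₚ suc j) ⊕ (constℤ e ⊗ geomSumAt e β j)))
    ≈⟨ reorder (constℤ e) (constℤ (e ℤ.^ suc j)) β (β ^ₚ suc j) (geomSumAt e β j) ⟩
  (β ⊗ (β ^ₚ suc j)) ⊕ (constℤ e ⊗ (constℤ (e ℤ.^ suc j) ⊕ (β ⊗ geomSumAt e β j)))  ∎
  where
  open SetoidReasoning ≋-setoid
  reorder : ∀ c d β p q → ((c ⊗ d) ⊕ (β ⊗ (p ⊕ (c ⊗ q)))) ≋ ((β ⊗ p) ⊕ (c ⊗ (d ⊕ (β ⊗ q))))
  reorder = solve-∀ ℚ[x]

-- The family 𝓕

module Family (k : ℕ) (a b c : ℤ) where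

  private
    regroup : ∀ t p q r s → ((t ⊗ p) ⊕ (r ⊗ ((t ⊗ q) ⊕ s))) ≋ ((t ⊗ (p ⊕ (r ⊗ q))) ⊕ (r ⊗ s))
    regroup = solve-∀ ℚ[x]

  θ : Poly
  θ = (X ^ₚ k) ⊕ const (ι b)

  -- geomSum n is literally the sum occurring in 𝓕, so 𝓕 n k a b c is by definition
  -- θ ^ₚ n ⊕ scale (ι c) (geomSum n).
  geomTerm : ℕ → ℕ → Poly
  geomTerm n j = scale (ι (a ℤ.^ j)) (θ ^ₚ (n ∸ suc j))

  geomSum : ℕ → Poly
  geomSum n = sumₚ (map (geomTerm n) (upTo n))

  geomSum-suc : ∀ n → geomSum (suc n) ≋ ((θ ^ₚ n) ⊕ (constℤ a ⊗ geomSum n))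
  geomSum-suc n = ≋-trans (≋-reflexive (sumₚ-upTo-suc (geomTerm (suc n)) n))
    (⊕-cong (scale-1 (θ ^ₚ n)) (≋-trans (sumₚ-map-cong (upTo n) shift) (sumₚ-map-const-⊗ (ι a) (geomTerm n) (upTo n))))
    where
    shift : ∀ j → geomTerm (suc n) (suc j) ≋ (constℤ a ⊗ geomTerm n j)
    shift j = ≋-trans (scale-cong (ι-* a (a ℤ.^ j)) ≋-refl)
             (≋-trans (≋-sym (scale-scale (ι a) (ι (a ℤ.^ j)) _)) (≋-sym (const-⊗ (ι a) (geomTerm n j))))

  geomSum-1 : geomSum 1 ≋ const 1ℚ
  geomSum-1 = ⊕-congˡ (const 1ℚ) (⊗-zeroʳ (constℤ a))

  geomSum-horner : ∀ j → geomSum (suc j) ≋ ((θ ⊗ geomSum j) ⊕ constℤ (a ℤ.^ j))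
  geomSum-horner zero    = ≋-trans geomSum-1 (≋-sym (⊕-congʳ (const 1ℚ) (⊗-zeroʳ θ)))
  geomSum-horner (suc j) = begin
    geomSum (suc (suc j))                                                  ≈⟨ geomSum-suc (suc j) ⟩
    (θ ⊗ (θ ^ₚ j)) ⊕ (constℤ a ⊗ geomSum (suc j))                          ≈⟨ ⊕-congˡ (θ ⊗ (θ ^ₚ j)) (⊗-congˡ (constℤ a) (geomSum-horner j)) ⟩
    (θ ⊗ (θ ^ₚ j)) ⊕ (constℤ a ⊗ ((θ ⊗ geomSum j) ⊕ constℤ (a ℤ.^ j)))     ≈⟨ regroup θ (θ ^ₚ j) (geomSum j) (constℤ a) (constℤ (a ℤ.^ j)) ⟩
    (θ ⊗ ((θ ^ₚ j) ⊕ (constℤ a ⊗ geomSum j))) ⊕ (constℤ a ⊗ constℤ (a ℤ.^ j))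
      ≈⟨ ⊕-cong (⊗-congˡ θ (≋-sym (geomSum-suc j))) (≋-sym (constℤ-* a (a ℤ.^ j))) ⟩
    (θ ⊗ geomSum (suc j)) ⊕ constℤ (a ℤ.^ suc j)                          ∎
    where open SetoidReasoning ≋-setoid

  𝓕-quot : ℕ → Poly
  𝓕-quot j = (θ ^ₚ j) ⊕ (constℤ c ⊗ geomSum j)

  𝓕-rem : ℕ → ℤ
  𝓕-rem j = c ℤ.* a ℤ.^ j

  𝓕-split : ∀ j → 𝓕 (suc j) k a b c ≋ ((θ ⊗ 𝓕-quot j) ⊕ constℤ (𝓕-rem j))
  𝓕-split j = begin
    𝓕 (suc j) k a b c                                                      ≈⟨ ⊕-congˡ (θ ⊗ (θ ^ₚ j)) (≋-sym (const-⊗ (ι c) (geomSum (suc j)))) ⟩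
    (θ ⊗ (θ ^ₚ j)) ⊕ (constℤ c ⊗ geomSum (suc j))                          ≈⟨ ⊕-congˡ (θ ⊗ (θ ^ₚ j)) (⊗-congˡ (constℤ c) (geomSum-horner j)) ⟩
    (θ ⊗ (θ ^ₚ j)) ⊕ (constℤ c ⊗ ((θ ⊗ geomSum j) ⊕ constℤ (a ℤ.^ j)))     ≈⟨ regroup θ (θ ^ₚ j) (geomSum j) (constℤ c) (constℤ (a ℤ.^ j)) ⟩
    (θ ⊗ 𝓕-quot j) ⊕ (constℤ c ⊗ constℤ (a ℤ.^ j))                         ≈⟨ ⊕-congˡ (θ ⊗ 𝓕-quot j) (≋-sym (constℤ-* c (a ℤ.^ j))) ⟩
    (θ ⊗ 𝓕-quot j) ⊕ constℤ (𝓕-rem j)                                     ∎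
    where open SetoidReasoning ≋-setoid

  𝓕-factor-a≡0 : a ≡ + 0 → ∀ j → 𝓕 (suc (suc j)) k a b c ≋ ((θ ^ₚ suc j) ⊗ (θ ⊕ constℤ c))
  𝓕-factor-a≡0 refl j = begin
    𝓕 (suc (suc j)) k (+ 0) b c                                            ≈⟨ ⊕-congˡ (θ ⊗ (θ ^ₚ suc j)) (≋-sym (const-⊗ (ι c) (geomSum (suc (suc j))))) ⟩
    (θ ⊗ (θ ^ₚ suc j)) ⊕ (constℤ c ⊗ geomSum (suc (suc j)))                ≈⟨ ⊕-congˡ (θ ⊗ (θ ^ₚ suc j)) (⊗-congˡ (constℤ c) geomSum≋θ^) ⟩
    (θ ⊗ (θ ^ₚ suc j)) ⊕ (constℤ c ⊗ (θ ^ₚ suc j))                         ≈⟨ factor θ (θ ^ₚ suc j) (constℤ c) ⟩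
    (θ ^ₚ suc j) ⊗ (θ ⊕ constℤ c)                                          ∎
    where
    open SetoidReasoning ≋-setoid
    factor : ∀ θ p c → ((θ ⊗ p) ⊕ (c ⊗ p)) ≋ (p ⊗ (θ ⊕ c))
    factor = solve-∀ ℚ[x]
    geomSum≋θ^ : geomSum (suc (suc j)) ≋ (θ ^ₚ suc j)
    geomSum≋θ^ = ≋-trans (geomSum-suc (suc j))
      (≋-trans (⊕-cong (≋-refl {θ ^ₚ suc j}) (⊗-zeroˡ (geomSum (suc j)) 0∷[]≋[])) (⊕-identityʳ (θ ^ₚ suc j)))

  θ-ℤ : HasℤCoeffs θ
  θ-ℤ = HasℤCoeffs-⊕ (X ^ₚ k) (const (ι b)) (HasℤCoeffs-^ X HasℤCoeffs-X k) (HasℤCoeffs-constℤ b)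

  𝓕-ℤ : ∀ n → HasℤCoeffs (𝓕 n k a b c)
  𝓕-ℤ n = HasℤCoeffs-⊕ (θ ^ₚ n) _ (HasℤCoeffs-^ θ θ-ℤ n)
    (HasℤCoeffs-scale (geomSum n) (c , refl) (HasℤCoeffs-sumₚ (geomTerm n) (upTo n) (λ j →
      HasℤCoeffs-scale (θ ^ₚ (n ∸ suc j)) (a ℤ.^ j , refl) (HasℤCoeffs-^ θ θ-ℤ (n ∸ suc j)))))

  module _ .{{_ : ℕ.NonZero k}} where

    θ-monic : MonicOfDegree θ k
    θ-monic = MonicOfDegree-⊕ (X ^ₚ k) (const (ι b)) (X^-monic k)
      (DegreeBelow-mono (const (ι b)) (ℕ.>-nonZero⁻¹ k) (DegreeBelow-const (ι b)))

    θ^-monic : ∀ j → MonicOfDegree (θ ^ₚ j) (j * k)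
    θ^-monic = MonicOfDegree-^ θ θ-monic

    geomSum-degree : ∀ j → DegreeBelow (geomSum j) (j * k)
    geomSum-degree zero    = λ _ _ → refl
    geomSum-degree (suc j) = DegreeBelow-≋ (≋-sym (geomSum-suc j)) (DegreeBelow-⊕ (θ ^ₚ j) _
      (DegreeBelow-mono (θ ^ₚ j) (ℕP.+-monoˡ-≤ (j * k) (ℕ.>-nonZero⁻¹ k)) (proj₁ (θ^-monic j)))
      (DegreeBelow-const-⊗ (ι a) (geomSum j) (DegreeBelow-mono (geomSum j) (ℕP.m≤n+m (j * k) k) (geomSum-degree j))))

    𝓕-monic : ∀ n → MonicOfDegree (𝓕 n k a b c) (n * k)
    𝓕-monic n = MonicOfDegree-⊕ (θ ^ₚ n) _ (θ^-monic n) (DegreeBelow-scale (ι c) (geomSum n) (geomSum-degree n))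

    𝓕-quot-monic : ∀ j → MonicOfDegree (𝓕-quot j) (j * k)
    𝓕-quot-monic j = MonicOfDegree-⊕ (θ ^ₚ j) _ (θ^-monic j) (DegreeBelow-const-⊗ (ι c) (geomSum j) (geomSum-degree j))

    𝓕-reducible-a≡0 : a ≡ + 0 → ∀ j → ¬ IrreducibleOverℚ (𝓕 (suc (suc j)) k a b c)
    𝓕-reducible-a≡0 a≡0 j (_ , _ , irreducible) =
      [ monic⇒¬IsUnit (θ ^ₚ suc j) {{ℕP.m*n≢0 (suc j) k}} (θ^-monic (suc j))
      , monic⇒¬IsUnit (θ ⊕ constℤ c) θ+c-monic
      ]′ (irreducible (θ ^ₚ suc j) (θ ⊕ constℤ c) (at (≋-sym (𝓕-factor-a≡0 a≡0 j))))
      where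
      θ+c-monic : MonicOfDegree (θ ⊕ constℤ c) k
      θ+c-monic = MonicOfDegree-⊕ θ (constℤ c) θ-monic
        (DegreeBelow-mono (constℤ c) (ℕ.>-nonZero⁻¹ k) (DegreeBelow-const (ι c)))

  module _ {M β : Poly} {e : ℤ} (θβ≡ea : (θ ⊗ β) ≡ constℤ (e ℤ.* a) mod M) where
    open SetoidReasoning (≡mod-setoid {M})

    β^-geomSum : ∀ j → ((β ^ₚ suc j) ⊗ geomSum (suc j)) ≡ (constℤ (a ℤ.^ j) ⊗ (β ⊗ geomSumAt e β j)) mod M
    β^-geomSum zero = ≋⇒≡mod (≋-trans (⊗-congˡ (β ⊗ const 1ℚ) geomSum-1)
      (≋-trans (swap β (const 1ℚ)) (⊗-congˡ (const 1ℚ) (⊗-congˡ β (≋-sym (geomSumAt-0 e β))))))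
      where
      swap : ∀ β one → ((β ⊗ one) ⊗ one) ≋ (one ⊗ (β ⊗ one))
      swap = solve-∀ ℚ[x]
    β^-geomSum (suc j) = begin
      (β ^ₚ suc (suc j)) ⊗ geomSum (suc (suc j))
        ≈⟨ ≋⇒≡mod (≋-trans (⊗-congˡ (β ^ₚ suc (suc j)) (geomSum-horner (suc j))) (expand β (β ^ₚ suc j) θ (geomSum (suc j)) (constℤ (a ℤ.^ suc j)))) ⟩
      ((θ ⊗ β) ⊗ ((β ^ₚ suc j) ⊗ geomSum (suc j))) ⊕ (constℤ (a ℤ.^ suc j) ⊗ (β ⊗ (β ^ₚ suc j)))
        ≈⟨ ⊕-cong-mod (⊗-cong-mod θβ≡ea (β^-geomSum j)) ≡mod-refl ⟩
      (constℤ (e ℤ.* a) ⊗ (constℤ (a ℤ.^ j) ⊗ (β ⊗ geomSumAt e β j))) ⊕ (constℤ (a ℤ.^ suc j) ⊗ (β ⊗ (β ^ₚ suc j)))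
        ≈⟨ ≋⇒≡mod (⊕-cong (⊗-congʳ (constℤ (a ℤ.^ j) ⊗ (β ⊗ geomSumAt e β j)) (constℤ-* e a)) (⊗-congʳ (β ⊗ (β ^ₚ suc j)) (constℤ-* a (a ℤ.^ j)))) ⟩
      ((constℤ e ⊗ constℤ a) ⊗ (constℤ (a ℤ.^ j) ⊗ (β ⊗ geomSumAt e β j))) ⊕ ((constℤ a ⊗ constℤ (a ℤ.^ j)) ⊗ (β ⊗ (β ^ₚ suc j)))
        ≈⟨ ≋⇒≡mod (collect (constℤ e) (constℤ a) (constℤ (a ℤ.^ j)) β (geomSumAt e β j) (β ^ₚ suc j)) ⟩
      (constℤ a ⊗ constℤ (a ℤ.^ j)) ⊗ (β ⊗ ((β ^ₚ suc j) ⊕ (constℤ e ⊗ geomSumAt e β j)))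
        ≈⟨ ≋⇒≡mod (⊗-cong (≋-sym (constℤ-* a (a ℤ.^ j))) (⊗-congˡ β (≋-sym (geomSumAt-suc e β j)))) ⟩
      constℤ (a ℤ.^ suc j) ⊗ (β ⊗ geomSumAt e β (suc j))  ∎
      where
      expand : ∀ β βʲ θ T A → ((β ⊗ βʲ) ⊗ ((θ ⊗ T) ⊕ A)) ≋ (((θ ⊗ β) ⊗ (βʲ ⊗ T)) ⊕ (A ⊗ (β ⊗ βʲ)))
      expand = solve-∀ ℚ[x]
      collect : ∀ E A Aʲ β P βʲ → (((E ⊗ A) ⊗ (Aʲ ⊗ (β ⊗ P))) ⊕ ((A ⊗ Aʲ) ⊗ (β ⊗ βʲ))) ≋ ((A ⊗ Aʲ) ⊗ (β ⊗ (βʲ ⊕ (E ⊗ P))))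
      collect = solve-∀ ℚ[x]

    β^-𝓕 : ∀ j → ((β ^ₚ suc j) ⊗ 𝓕 (suc j) k a b c)
               ≡ (constℤ ((e ℤ.* a) ℤ.^ suc j) ⊕ (constℤ (𝓕-rem j) ⊗ (β ⊗ geomSumAt e β j))) mod M
    β^-𝓕 j = begin
      (β ^ₚ suc j) ⊗ 𝓕 (suc j) k a b c
        ≈⟨ ≋⇒≡mod (≋-trans (⊗-congˡ (β ^ₚ suc j) (⊕-congˡ (θ ^ₚ suc j) (≋-sym (const-⊗ (ι c) (geomSum (suc j))))))
                           (distrib (β ^ₚ suc j) (θ ^ₚ suc j) (constℤ c) (geomSum (suc j)))) ⟩
      ((θ ^ₚ suc j) ⊗ (β ^ₚ suc j)) ⊕ (constℤ c ⊗ ((β ^ₚ suc j) ⊗ geomSum (suc j)))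
        ≈⟨ ≋⇒≡mod (⊕-congʳ _ (≋-sym (^ₚ-distrib-⊗ θ β (suc j)))) ⟩
      ((θ ⊗ β) ^ₚ suc j) ⊕ (constℤ c ⊗ ((β ^ₚ suc j) ⊗ geomSum (suc j)))
        ≈⟨ ⊕-cong-mod (^ₚ-cong-mod (suc j) θβ≡ea) (⊗-congˡ-mod (constℤ c) (β^-geomSum j)) ⟩
      (constℤ (e ℤ.* a) ^ₚ suc j) ⊕ (constℤ c ⊗ (constℤ (a ℤ.^ j) ⊗ (β ⊗ geomSumAt e β j)))
        ≈⟨ ≋⇒≡mod (⊕-cong (≋-sym (constℤ-^ (e ℤ.* a) (suc j)))
                          (≋-trans (≋-sym (⊗-assoc (constℤ c) (constℤ (a ℤ.^ j)) _)) (⊗-congʳ _ (≋-sym (constℤ-* c (a ℤ.^ j)))))) ⟩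
      constℤ ((e ℤ.* a) ℤ.^ suc j) ⊕ (constℤ (𝓕-rem j) ⊗ (β ⊗ geomSumAt e β j))  ∎
      where
      distrib : ∀ B Θ C T → (B ⊗ (Θ ⊕ (C ⊗ T))) ≋ ((Θ ⊗ B) ⊕ (C ⊗ (B ⊗ T)))
      distrib = solve-∀ ℚ[x]

  module Witness (m p : ℕ) {{_ : ℕ.NonZero p}} (a′ : ℤ) (a≡a′p : a ≡ a′ ℤ.* + p) where

    n : ℕ
    n = suc (suc (suc m))

    F : Poly
    F = 𝓕 n k a b c

    D : ℤ
    D = 𝓕-rem (suc (suc m))

    -- The names record the values of these integers in terms of D and a = a′p; n ≥ 3 is
    -- what makes D/pa = c aⁿ⁻³ a′, and hence all of them, integers.
    D/pa : ℤ
    D/pa = c ℤ.* a ℤ.^ m ℤ.* a′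

    D/p : ℤ
    D/p = D/pa ℤ.* a

    D/p² : ℤ
    D/p² = D/pa ℤ.* a′

    Dⁿ⁻¹/pⁿ : ℤ
    Dⁿ⁻¹/pⁿ = D/p ℤ.^ suc m ℤ.* D/p²

    D/p≡p*D/p² : D/p ≡ + p ℤ.* D/p²
    D/p≡p*D/p² = trans (cong (D/pa ℤ.*_) a≡a′p) (identity D/pa a′ (+ p))
      where
      identity : ∀ x a′ p → x ℤ.* (a′ ℤ.* p) ≡ p ℤ.* (x ℤ.* a′)
      identity = solve-∀ ℤ-ring

    D≡p*D/p : D ≡ + p ℤ.* D/p
    D≡p*D/p = trans (cong (λ x → c ℤ.* (x ℤ.* (a ℤ.* a ℤ.^ m))) a≡a′p) (identity c a (a ℤ.^ m) a′ (+ p))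
      where
      identity : ∀ c a aᵐ a′ p → c ℤ.* ((a′ ℤ.* p) ℤ.* (a ℤ.* aᵐ)) ≡ p ℤ.* (c ℤ.* aᵐ ℤ.* a′ ℤ.* a)
      identity = solve-∀ ℤ-ring

    [D/p]ⁿ≡D*Dⁿ⁻¹/pⁿ : D/p ℤ.^ n ≡ D ℤ.* Dⁿ⁻¹/pⁿ
    [D/p]ⁿ≡D*Dⁿ⁻¹/pⁿ = begin
      D/p ℤ.* (D/p ℤ.* (D/p ℤ.* D/p ℤ.^ m))                 ≡⟨ cong (λ x → D/p ℤ.* (D/p ℤ.* (x ℤ.* D/p ℤ.^ m))) D/p≡p*D/p² ⟩
      D/p ℤ.* (D/p ℤ.* ((+ p ℤ.* D/p²) ℤ.* D/p ℤ.^ m))      ≡⟨ identity D/p D/p² (+ p) (D/p ℤ.^ m) ⟩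
      (+ p ℤ.* D/p) ℤ.* Dⁿ⁻¹/pⁿ                             ≡⟨ cong (ℤ._* Dⁿ⁻¹/pⁿ) D≡p*D/p ⟨
      D ℤ.* Dⁿ⁻¹/pⁿ                                          ∎
      where
      open ≡-Reasoning
      identity : ∀ t t′ p tᵐ → t ℤ.* (t ℤ.* ((p ℤ.* t′) ℤ.* tᵐ)) ≡ (p ℤ.* t) ℤ.* ((t ℤ.* tᵐ) ℤ.* t′)
      identity = solve-∀ ℤ-ring

    private instance
      ι[p]-nonZero : ℚ.NonZero (ι (+ p))
      ι[p]-nonZero = ι-nonZero p

    -1/p : ℚ
    -1/p = ℚ.- (ℚ.1/ ι (+ p))

    p*-1/p≡-1 : ι (+ p) ℚ.* -1/p ≡ ℚ.- 1ℚ
    p*-1/p≡-1 = trans (sym (ℚP.neg-distribʳ-* (ι (+ p)) (ℚ.1/ ι (+ p)))) (cong ℚ.-_ (ℚP.*-inverseʳ (ι (+ p))))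

    β : Poly
    β = const -1/p ⊗ 𝓕-quot (suc (suc m))

    θ𝓕-quot≡-D : (θ ⊗ 𝓕-quot (suc (suc m))) ≡ neg (constℤ D) mod F
    θ𝓕-quot≡-D = begin
      θ ⊗ S                                    ≈⟨ ≋⇒≡mod (add-sub (θ ⊗ S) (constℤ D)) ⟩
      ((θ ⊗ S) ⊕ constℤ D) ⊕ neg (constℤ D)    ≈⟨ ≋⇒≡mod (⊕-congʳ (neg (constℤ D)) (≋-sym (𝓕-split (suc (suc m))))) ⟩
      F ⊕ neg (constℤ D)                       ≈⟨ ⊕-cong-mod modulus≡0 ≡mod-refl ⟩
      neg (constℤ D)                           ∎
      where
      open SetoidReasoning (≡mod-setoid {F})
      S : Poly
      S = 𝓕-quot (suc (suc m))
      add-sub : ∀ x y → x ≋ ((x ⊕ y) ⊕ neg y)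
      add-sub = solve-∀ ℚ[x]

    -1/p*-D≡D/p : -1/p ℚ.* ((ℚ.- 1ℚ) ℚ.* ι D) ≡ ι D/p
    -1/p*-D≡D/p = begin
      -1/p ℚ.* ((ℚ.- 1ℚ) ℚ.* ι D)                      ≡⟨ cong (λ x → -1/p ℚ.* ((ℚ.- 1ℚ) ℚ.* x)) (trans (cong ι D≡p*D/p) (ι-* (+ p) D/p)) ⟩
      -1/p ℚ.* ((ℚ.- 1ℚ) ℚ.* (ι (+ p) ℚ.* ι D/p))      ≡⟨ -u*-[v*x]≡u*v*x (ℚ.1/ ι (+ p)) (ι (+ p)) (ι D/p) ⟩
      (ℚ.1/ ι (+ p) ℚ.* ι (+ p)) ℚ.* ι D/p             ≡⟨ cong (ℚ._* ι D/p) (ℚP.*-inverseˡ (ι (+ p))) ⟩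
      1ℚ ℚ.* ι D/p                                     ≡⟨ ℚP.*-identityˡ (ι D/p) ⟩
      ι D/p                                            ∎
      where
      open ≡-Reasoning
      -u*-[v*x]≡u*v*x : ∀ u v x → (ℚ.- u) ℚ.* ((ℚ.- 1ℚ) ℚ.* (v ℚ.* x)) ≡ (u ℚ.* v) ℚ.* x
      -u*-[v*x]≡u*v*x = solve-∀ ℚ-ring

    θβ≡D/p : (θ ⊗ β) ≡ constℤ D/p mod F
    θβ≡D/p = begin
      θ ⊗ (const -1/p ⊗ S)                 ≈⟨ ≋⇒≡mod (left-comm θ (const -1/p) S) ⟩
      const -1/p ⊗ (θ ⊗ S)                 ≈⟨ ⊗-congˡ-mod (const -1/p) θ𝓕-quot≡-D ⟩
      const -1/p ⊗ neg (constℤ D)          ≈⟨ ≋⇒≡mod (≋-trans (≋-sym (const-* -1/p _)) (∷-cong -1/p*-D≡D/p ≋-refl)) ⟩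
      constℤ D/p                           ∎
      where
      open SetoidReasoning (≡mod-setoid {F})
      S : Poly
      S = 𝓕-quot (suc (suc m))
      left-comm : ∀ x y z → (x ⊗ (y ⊗ z)) ≋ (y ⊗ (x ⊗ z))
      left-comm = solve-∀ ℚ[x]
    β-integral : D ≢ + 0 → IsAlgebraicInteger F β
    β-integral D≢0 = Dⁿ⁻¹/pⁿ ∷ descendingPowers D/pa (suc (suc m)) ,
                     ≡mod[]⇒∣ₚ (const-⊗-cancel-mod (ι D) {{ιD≢0}} D⊗G≡0)
      where
      P : Poly
      P = geomSumAt D/pa β (suc (suc m))
      ιD≢0 : ℚ.NonZero (ι D)
      ιD≢0 = ℚ.≢-nonZero (λ ιD≡0 → D≢0 (ι-injective ιD≡0))
      open SetoidReasoning (≡mod-setoid {F})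
      D⊗G≡0 : (constℤ D ⊗ (constℤ Dⁿ⁻¹/pⁿ ⊕ (β ⊗ P))) ≡ [] mod F
      D⊗G≡0 = begin
        constℤ D ⊗ (constℤ Dⁿ⁻¹/pⁿ ⊕ (β ⊗ P))              ≈⟨ ≋⇒≡mod (⊗-distribˡ (constℤ D) (constℤ Dⁿ⁻¹/pⁿ) (β ⊗ P)) ⟩
        (constℤ D ⊗ constℤ Dⁿ⁻¹/pⁿ) ⊕ (constℤ D ⊗ (β ⊗ P))  ≈⟨ ≋⇒≡mod (⊕-congʳ (constℤ D ⊗ (β ⊗ P))
                                                                 (≋-trans (≋-sym (constℤ-* D Dⁿ⁻¹/pⁿ)) (≋-reflexive (cong constℤ (sym [D/p]ⁿ≡D*Dⁿ⁻¹/pⁿ))))) ⟩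
        constℤ (D/p ℤ.^ n) ⊕ (constℤ D ⊗ (β ⊗ P))           ≈⟨ ≡mod-sym (β^-𝓕 θβ≡D/p (suc (suc m))) ⟩
        (β ^ₚ n) ⊗ F                                        ≈⟨ ⊗-congˡ-mod (β ^ₚ n) modulus≡0 ⟩
        (β ^ₚ n) ⊗ []                                       ≈⟨ ≋⇒≡mod (⊗-zeroʳ (β ^ₚ n)) ⟩
        []                                                  ∎

    module _ .{{_ : ℕ.NonZero k}} where

      β-degree : DegreeBelow β (n * k)
      β-degree = DegreeBelow-const-⊗ -1/p (𝓕-quot (suc (suc m)))
        (DegreeBelow-mono (𝓕-quot (suc (suc m))) (ℕP.+-monoˡ-≤ (suc (suc m) * k) (ℕ.>-nonZero⁻¹ k))
                          (proj₁ (𝓕-quot-monic (suc (suc m)))))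

      β-top-coeff : coeff β (suc (suc m) * k) ≡ -1/p
      β-top-coeff = begin
        coeff β (suc (suc m) * k)                                ≡⟨ coeff-const-⊗ -1/p S (suc (suc m) * k) ⟩
        -1/p ℚ.* coeff S (suc (suc m) * k)                       ≡⟨ cong (-1/p ℚ.*_) (proj₂ (𝓕-quot-monic (suc (suc m)))) ⟩
        -1/p ℚ.* 1ℚ                                              ≡⟨ ℚP.*-identityʳ -1/p ⟩
        -1/p                                                     ∎
        where
        open ≡-Reasoning
        S : Poly
        S = 𝓕-quot (suc (suc m))

      β∉ℤ[α] : p ≢ 1 → ¬ InZα F β
      β∉ℤ[α] p≢1 (h , F∣β-h) =
        let r , r-ℤ , r<nk , h≡r = reduce-mod-monic (𝓕-monic n) (𝓕-ℤ n) h
            β≋r : β ≋ r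
            β≋r = ≡mod-reduced⇒≋ (𝓕-monic n) β-degree r<nk (≡mod-trans (∣ₚ⇒≡mod F∣β-h) h≡r)
            top : ℕ
            top = suc (suc m) * k
        in p*x≡-1⇒¬Isℤ[x] p p≢1 p*-1/p≡-1 (subst Isℤ (trans (sym (at β≋r top)) β-top-coeff) (isℤ r-ℤ top))

  𝓕-not-monogenic : ∀ m p .{{_ : ℕ.NonZero k}} → Prime p → + p ∣ a → c ≢ + 0 → a ≢ + 0 →
                    ¬ Monogenic (𝓕 (suc (suc (suc m))) k a b c)
  𝓕-not-monogenic m p p-prime p∣a c≢0 a≢0 (integral⇒∈ℤ[α] , _) =
    β∉ℤ[α] (ℕ.nonTrivial⇒≢1 {{prime⇒nonTrivial p-prime}}) (integral⇒∈ℤ[α] β (β-integral D≢0))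
    where
    p∣ₛa : + p ℤ∣.∣ a
    p∣ₛa = ℤ∣.∣ᵤ⇒∣ p∣a
    open Witness m p {{prime⇒nonZero p-prime}} (ℤ∣._∣_.quotient p∣ₛa) (ℤ∣._∣_.equality p∣ₛa)
    D≢0 : D ≢ + 0
    D≢0 D≡0 = [ c≢0 , a≢0 ∘ ℤP.i^n≡0⇒i≡0 a (suc (suc m)) ]′ (ℤP.i*j≡0⇒i≡0∨j≡0 c D≡0)

proposition2p5 : (n k : ℕ) → 3 ≤ n → 1 ≤ k → (a b c : ℤ)
    → IrreducibleOverℚ (𝓕 n k a b c)
    → HasDegree (𝓕 n k a b c) (n * k)
    → Σ ℕ (λ p → Prime p × (+ p ∣ a) × ¬ (+ p ∣ c))
    → ¬ Monogenic (𝓕 n k a b c)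
proposition2p5 (suc (suc (suc m))) (suc k′) (s≤s (s≤s (s≤s _))) (s≤s _) a b c irreducible _ (p , p-prime , p∣a , p∤c) =
  by-cases (a ℤ.≟ + 0)
  where
  open Family (suc k′) a b c
  c≢0 : c ≢ + 0
  c≢0 refl = p∤c (p ℕ∣.∣0)
  by-cases : Dec (a ≡ + 0) → ¬ Monogenic (𝓕 (suc (suc (suc m))) (suc k′) a b c)
  by-cases (yes a≡0) _ = 𝓕-reducible-a≡0 a≡0 (suc m) irreducible
  by-cases (no a≢0)    = 𝓕-not-monogenic m p p-prime p∣a c≢0 a≢0
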